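{- Let $\epsilon>0$ be sufficiently small with $M=1/\epsilon$ an integer, and let $m=2/\epsilon$ (an integer). Let $G$ be the weighted graph with vertex set $V=V_1\cup\dots\cup V_m$ (disjoint), $|V_i|=M^i$, in which every pair of distinct vertices inside a common $V_i$ is joined by an edge of weight $1$, every pair $u\in V_i$, $v\in V_{i+1}$ ($1\le i\le m-1$) is joined by an edge of weight $\frac12+\epsilon$, and there are no other edges. Then there exist $x_u\in[-1,1]$ ($u\in V$), not all zero, such that \[\frac{\sum_{\{u,v\}\in E(G)}-w_{uv}x_ux_v}{\sum_{\{u,v\}\in E(G)}|w_{uv}|(x_u^2+x_v^2)}=\Omega(\epsilon^2),\] where $w_{uv}$ denotes the weight of edge $\{u,v\}$ and the implied constant is absolute. -}

module Defs where

open import Data.Nat as ℕ using (ℕ; zero; suc; _^_; _∸_; _<ᵇ_)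
open import Data.Fin using (Fin; toℕ)
open import Data.Bool using (if_then_else_)
open import Data.Integer using (+_)
open import Data.Rational using (ℚ; 0ℚ; 1ℚ; _+_; _*_; -_; ∣_∣; _/_)

sumℕ : ℕ → (ℕ → ℚ) → ℚ
sumℕ zero    f = 0ℚ
sumℕ (suc n) f = sumℕ n f + f n

sumFin : (n : ℕ) → (Fin n → ℚ) → ℚ
sumFin zero    f = 0ℚ
sumFin (suc n) f = f Fin.zero + sumFin n (λ j → f (Fin.suc j))

-- Parameters: M = 1/ε, m = 2/ε = 2M levels.
-- Level i (0-based, i < m) is the paper's V_{i+1}, of size M^(i+1).
numLevels : ℕ → ℕ
numLevels M = 2 ℕ.* M

levelSize : ℕ → ℕ → ℕ
levelSize M i = M ^ suc i

eps : (M : ℕ) → .{{_ : ℕ.NonZero M}} → ℚ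
eps M = + 1 / M

crossWeight : (M : ℕ) → .{{_ : ℕ.NonZero M}} → ℚ
crossWeight M = (+ 1 / 2) + eps M

-- an assignment x_u to the vertices: x i j is the value at the j-th vertex of level i
-- (values at levels i ≥ numLevels M are irrelevant)
Assignment : ℕ → Set
Assignment M = (i : ℕ) → Fin (levelSize M i) → ℚ

-- Σ over the edges {u,v} of G of F w_uv x_u x_v.
-- Edges inside a level: unordered pairs {j,k} with j < k, weight 1.
-- Edges between level i and i+1 (0 ≤ i < m-1): all pairs, weight 1/2+ε.
edgeSum : (M : ℕ) → .{{_ : ℕ.NonZero M}} → Assignment M → (ℚ → ℚ → ℚ → ℚ) → ℚ
edgeSum M x F = intra + inter
  where
  intra = sumℕ (numLevels M) λ i →
            sumFin (levelSize M i) λ k →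
              sumFin (levelSize M i) λ j →
                if toℕ j <ᵇ toℕ k then F 1ℚ (x i j) (x i k) else 0ℚ
  inter = sumℕ (numLevels M ∸ 1) λ i →
            sumFin (levelSize M i) λ j →
              sumFin (levelSize M (suc i)) λ k →
                F (crossWeight M) (x i j) (x (suc i) k)

numer : (M : ℕ) → .{{_ : ℕ.NonZero M}} → Assignment M → ℚ
numer M x = edgeSum M x (λ w a b → - (w * a * b))

denom : (M : ℕ) → .{{_ : ℕ.NonZero M}} → Assignment M → ℚ
denom M x = edgeSum M x (λ w a b → ∣ w ∣ * (a * a + b * b))

-- The witness is a "dipole": x = 1 and x = -1 on two vertices of the smallest level
-- V_1, and x = 0 elsewhere.  Its only edge with a nonzero product is the edge joining
-- the two poles, so the numerator is exactly 1.  Every other edge meeting a pole adds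
-- at most a constant to the denominator, which is therefore
--   D = 2 + 2(M-2) + 2 M² (½ + ε),   and   ε² D = 1 + 4ε - 2ε² ≤ 5.
module Submission where

open import Defs
open import Data.Nat as ℕ using (ℕ)
open import Data.Fin using (Fin)
open import Data.Product using (Σ; ∃; _×_)
open import Data.Integer using (-[1+_])
open import Data.Rational using (ℚ; 0ℚ; 1ℚ; _*_; _≤_; _<_; _/_)
open import Relation.Binary.PropositionalEquality using (_≢_)

open import Data.Nat using (zero; suc; _<ᵇ_)
import Data.Nat.Properties as ℕₚ
import Data.Nat.Coprimality as Coprimality
open import Data.Fin using (toℕ)
open import Data.Bool using (true; false; if_then_else_)
open import Data.Product using (_,_)
import Data.Integer as ℤ
import Data.Integer.Properties as ℤₚ
open import Data.Rational using (mkℚ; _+_; -_; ∣_∣; 1/_; ½; *≤*; _≤?_; nonNegative)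
open import Data.Rational.Properties
open import Data.Rational.Solver using (module +-*-Solver)
open import Relation.Binary.PropositionalEquality
  using (_≡_; refl; sym; trans; cong; cong₂; subst; module ≡-Reasoning)
open import Relation.Nullary.Decidable using (toWitness)

toℚ : ℕ → ℚ
toℚ n = mkℚ (ℤ.+ n) 0 (Coprimality.sym (Coprimality.1-coprimeTo n))

toℚ≡/1 : ∀ n → ℤ.+ n / 1 ≡ toℚ n
toℚ≡/1 n = ↥p/↧p≡p (toℚ n)

toℚ-+ : ∀ a b → toℚ (a ℕ.+ b) ≡ toℚ a + toℚ b
toℚ-+ a b = begin
  toℚ (a ℕ.+ b)                            ≡⟨ toℚ≡/1 (a ℕ.+ b) ⟨
  ℤ.+ (a ℕ.+ b) / 1                        ≡⟨ cong (_/ 1) (ℤₚ.pos-+ a b) ⟩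
  (ℤ.+ a ℤ.+ ℤ.+ b) / 1                    ≡⟨ cong (_/ 1) (cong₂ ℤ._+_ (ℤₚ.*-identityʳ (ℤ.+ a))
                                                                   (ℤₚ.*-identityʳ (ℤ.+ b))) ⟨
  (ℤ.+ a ℤ.* ℤ.+ 1 ℤ.+ ℤ.+ b ℤ.* ℤ.+ 1) / 1 ≡⟨⟩
  toℚ a + toℚ b                            ∎
  where open ≡-Reasoning

toℚ-* : ∀ a b → toℚ (a ℕ.* b) ≡ toℚ a * toℚ b
toℚ-* a b = trans (sym (toℚ≡/1 (a ℕ.* b))) (cong (_/ 1) (ℤₚ.pos-* a b))

eps≡1/ : ∀ K → eps (suc K) ≡ 1/ toℚ (suc K)
eps≡1/ K = ↥p/↧p≡p (1/ toℚ (suc K))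

toℚ*eps : ∀ K → toℚ (suc K) * eps (suc K) ≡ 1ℚ
toℚ*eps K = trans (cong (toℚ (suc K) *_) (eps≡1/ K)) (*-inverseʳ (toℚ (suc K)))

eps-nonNeg : ∀ M .{{_ : ℕ.NonZero M}} → 0ℚ ≤ eps M
eps-nonNeg M = nonNegative⁻¹ (eps M) {{normalize-nonNeg 1 M}}

eps≤1 : ∀ K → eps (suc K) ≤ 1ℚ
eps≤1 K rewrite eps≡1/ K = *≤* (ℤ.+≤+ (ℕ.s≤s ℕ.z≤n))

sumFin-cong : ∀ n {f g : Fin n → ℚ} → (∀ j → f j ≡ g j) → sumFin n f ≡ sumFin n g
sumFin-cong zero    f≡g = refl
sumFin-cong (suc n) f≡g = cong₂ _+_ (f≡g Fin.zero) (sumFin-cong n (λ j → f≡g (Fin.suc j)))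

sumFin-zero : ∀ n {f : Fin n → ℚ} → (∀ j → f j ≡ 0ℚ) → sumFin n f ≡ 0ℚ
sumFin-zero n f≡0 = trans (sumFin-cong n f≡0) (zeros n)
  where
  zeros : ∀ n → sumFin n (λ _ → 0ℚ) ≡ 0ℚ
  zeros zero    = refl
  zeros (suc n) = cong (0ℚ +_) (zeros n)

sumFin-const : ∀ n q → sumFin n (λ _ → q) ≡ toℚ n * q
sumFin-const zero    q = sym (*-zeroˡ q)
sumFin-const (suc n) q = begin
  q + sumFin n (λ _ → q)   ≡⟨ cong₂ _+_ (sym (*-identityˡ q)) (sumFin-const n q) ⟩
  1ℚ * q + toℚ n * q       ≡⟨ *-distribʳ-+ q 1ℚ (toℚ n) ⟨
  (1ℚ + toℚ n) * q         ≡⟨ cong (_* q) (toℚ-+ 1 n) ⟨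
  toℚ (suc n) * q          ∎
  where open ≡-Reasoning

sumℕ-head : ∀ n (f : ℕ → ℚ) → (∀ i → f (suc i) ≡ 0ℚ) → sumℕ (suc n) f ≡ f 0
sumℕ-head zero    f f≡0 = +-identityˡ (f 0)
sumℕ-head (suc n) f f≡0 = trans (cong₂ _+_ (sumℕ-head n f f≡0) (f≡0 n)) (+-identityʳ (f 0))

if-zero : ∀ b {p : ℚ} → p ≡ 0ℚ → (if b then p else 0ℚ) ≡ 0ℚ
if-zero true  p≡0 = p≡0
if-zero false p≡0 = refl

cliqueSum : (n : ℕ) → (ℚ → ℚ → ℚ) → (Fin n → ℚ) → ℚ
cliqueSum n G y = sumFin n λ k → sumFin n λ j →
  if toℕ j <ᵇ toℕ k then G (y j) (y k) else 0ℚ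

bipartiteSum : (n n′ : ℕ) → (ℚ → ℚ → ℚ) → (Fin n → ℚ) → (Fin n′ → ℚ) → ℚ
bipartiteSum n n′ G y z = sumFin n λ j → sumFin n′ λ k → G (y j) (z k)

edgeSum-levels : ∀ M .{{_ : ℕ.NonZero M}} (x : Assignment M) F →
  edgeSum M x F ≡
    sumℕ (numLevels M) (λ i → cliqueSum (levelSize M i) (F 1ℚ) (x i))
    + sumℕ (numLevels M ℕ.∸ 1)
        (λ i → bipartiteSum (levelSize M i) (levelSize M (suc i)) (F (crossWeight M)) (x i) (x (suc i)))
edgeSum-levels M x F = refl

cliqueSum-zero : ∀ n G → G 0ℚ 0ℚ ≡ 0ℚ → cliqueSum n G (λ _ → 0ℚ) ≡ 0ℚ
cliqueSum-zero n G G00 = sumFin-zero n λ _ → sumFin-zero n λ _ → if-zero _ G00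

bipartiteSum-zero : ∀ n n′ G → G 0ℚ 0ℚ ≡ 0ℚ → bipartiteSum n n′ G (λ _ → 0ℚ) (λ _ → 0ℚ) ≡ 0ℚ
bipartiteSum-zero n n′ G G00 = sumFin-zero n λ _ → sumFin-zero n′ λ _ → G00

twoPointVec : ∀ {n} → ℚ → ℚ → Fin n → ℚ
twoPointVec a b j = entry (toℕ j)
  where
  entry : ℕ → ℚ
  entry 0             = a
  entry 1             = b
  entry (suc (suc _)) = 0ℚ

cliqueSum-twoPoint : ∀ n G a b → G 0ℚ 0ℚ ≡ 0ℚ →
  cliqueSum (suc (suc n)) G (twoPointVec a b) ≡ G a b + toℚ n * (G a 0ℚ + G b 0ℚ)
cliqueSum-twoPoint n G a b G00 = begin
  -- the unfolded sum: row k = 0 is empty, row k = 1 holds the edge {0,1}, and each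
  -- row k ≥ 2 holds the edges {0,k}, {1,k} and edges between zero vertices
  0ℚ + (0ℚ + sumFin n (λ _ → 0ℚ))
    + ((G a b + (0ℚ + sumFin n (λ _ → 0ℚ)))
       + sumFin n (λ k → G a 0ℚ + (G b 0ℚ + sumFin n (λ j → lowerRow k j))))
      ≡⟨ cong₂ (λ z rest → 0ℚ + z + ((G a b + z) + rest)) zeroRow (sumFin-cong n fullRow) ⟩
  0ℚ + (G a b + 0ℚ + sumFin n (λ _ → G a 0ℚ + G b 0ℚ))
      ≡⟨ +-identityˡ _ ⟩
  G a b + 0ℚ + sumFin n (λ _ → G a 0ℚ + G b 0ℚ)
      ≡⟨ cong₂ _+_ (+-identityʳ (G a b)) (sumFin-const n _) ⟩
  G a b + toℚ n * (G a 0ℚ + G b 0ℚ)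
      ∎
  where
  open ≡-Reasoning
  zeroRow : sumFin (suc n) (λ _ → 0ℚ) ≡ 0ℚ
  zeroRow = sumFin-zero (suc n) (λ _ → refl)
  lowerRow : Fin n → Fin n → ℚ
  lowerRow k j = if toℕ j <ᵇ toℕ k then G 0ℚ 0ℚ else 0ℚ
  fullRow : ∀ k → G a 0ℚ + (G b 0ℚ + sumFin n (lowerRow k)) ≡ G a 0ℚ + G b 0ℚ
  fullRow k = cong (λ z → G a 0ℚ + z)
    (trans (cong (G b 0ℚ +_) (sumFin-zero n (λ j → if-zero _ G00))) (+-identityʳ (G b 0ℚ)))

bipartiteSum-twoPoint : ∀ n n′ G a b → G 0ℚ 0ℚ ≡ 0ℚ →
  bipartiteSum (suc (suc n)) n′ G (twoPointVec a b) (λ _ → 0ℚ) ≡ toℚ n′ * (G a 0ℚ + G b 0ℚ)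
bipartiteSum-twoPoint n n′ G a b G00 = begin
  sumFin n′ (λ _ → G a 0ℚ) + (sumFin n′ (λ _ → G b 0ℚ) + bipartiteSum n n′ G (λ _ → 0ℚ) (λ _ → 0ℚ))
      ≡⟨ cong₂ (λ p q → p + (q + _)) (sumFin-const n′ _) (sumFin-const n′ _) ⟩
  toℚ n′ * G a 0ℚ + (toℚ n′ * G b 0ℚ + bipartiteSum n n′ G (λ _ → 0ℚ) (λ _ → 0ℚ))
      ≡⟨ cong (λ z → toℚ n′ * G a 0ℚ + z)
           (trans (cong (toℚ n′ * G b 0ℚ +_) (bipartiteSum-zero n n′ G G00)) (+-identityʳ _)) ⟩
  toℚ n′ * G a 0ℚ + toℚ n′ * G b 0ℚ
      ≡⟨ *-distribˡ-+ (toℚ n′) (G a 0ℚ) (G b 0ℚ) ⟨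
  toℚ n′ * (G a 0ℚ + G b 0ℚ)
      ∎
  where open ≡-Reasoning

twoPoint : (M : ℕ) → ℚ → ℚ → Assignment M
twoPoint M a b zero    = twoPointVec a b
twoPoint M a b (suc i) = λ _ → 0ℚ

InUnitInterval : ℚ → Set
InUnitInterval q = ((-[1+ 0 ] / 1) ≤ q) × (q ≤ 1ℚ)

twoPoint-bounded : ∀ M a b → InUnitInterval a → InUnitInterval b →
  ∀ i j → InUnitInterval (twoPoint M a b i j)
twoPoint-bounded M a b a∈I b∈I zero j with toℕ j
... | 0           = a∈I
... | 1           = b∈I
... | suc (suc _) = toWitness {a? = (-[1+ 0 ] / 1) ≤? 0ℚ} _ , toWitness {a? = 0ℚ ≤? 1ℚ} _
twoPoint-bounded M a b a∈I b∈I (suc i) j =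
  toWitness {a? = (-[1+ 0 ] / 1) ≤? 0ℚ} _ , toWitness {a? = 0ℚ ≤? 1ℚ} _

-- Closed form of the dipole's denominator in terms of k = M - 2 and ε:
-- 2 from the pole edge, 2k from the pole-to-level-0 edges, 2 M² (½ + ε) across.
dipoleDenom : ℚ → ℚ → ℚ
dipoleDenom k ε = (toℚ 2 + k * toℚ 2) + ((toℚ 2 + k) * (toℚ 2 + k)) * ((½ + ε) + (½ + ε))

*-nonNeg : ∀ {p q} → 0ℚ ≤ p → 0ℚ ≤ q → 0ℚ ≤ p * q
*-nonNeg {p} {q} 0≤p 0≤q =
  nonNegative⁻¹ (p * q) {{nonNeg*nonNeg⇒nonNeg p {{nonNegative 0≤p}} q {{nonNegative 0≤q}}}}

dipoleDenom-pos : ∀ k ε → 0ℚ ≤ k → 0ℚ ≤ ε → 0ℚ < dipoleDenom k ε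
dipoleDenom-pos k ε 0≤k 0≤ε =
  +-mono-<-≤ (+-mono-<-≤ (positive⁻¹ (toℚ 2)) (*-nonNeg 0≤k 0≤2))
             (*-nonNeg (*-nonNeg 0≤2+k 0≤2+k) (+-mono-≤ 0≤½+ε 0≤½+ε))
  where
  0≤2 : 0ℚ ≤ toℚ 2
  0≤2 = nonNegative⁻¹ (toℚ 2)
  0≤2+k : 0ℚ ≤ toℚ 2 + k
  0≤2+k = +-mono-≤ 0≤2 0≤k
  0≤½+ε : 0ℚ ≤ ½ + ε
  0≤½+ε = +-mono-≤ (nonNegative⁻¹ ½) 0≤ε

dipoleDenom-identity : ∀ k ε →
  ε * ε * dipoleDenom k ε + toℚ 2 * (ε * ε)
    ≡ toℚ 2 * ε * ((toℚ 2 + k) * ε) + ((toℚ 2 + k) * ε) * ((toℚ 2 + k) * ε) * ((½ + ε) + (½ + ε))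
dipoleDenom-identity = solve 2 (λ k ε →
    ε :* ε :* ((two :+ k :* two) :+ ((two :+ k) :* (two :+ k)) :* ((half :+ ε) :+ (half :+ ε)))
      :+ two :* (ε :* ε)
  := two :* ε :* ((two :+ k) :* ε)
      :+ ((two :+ k) :* ε) :* ((two :+ k) :* ε) :* ((half :+ ε) :+ (half :+ ε))) refl
  where
  open +-*-Solver
  two half : ∀ {n} → Polynomial n
  two  = con (toℚ 2)
  half = con ½

-- Since (2 + k) ε = 1 and 0 ≤ ε ≤ 1:  ε² D ≤ 2ε + 1 + 2ε ≤ 5.
dipoleDenom-bound : ∀ k ε → 0ℚ ≤ ε → ε ≤ 1ℚ → (toℚ 2 + k) * ε ≡ 1ℚ →
  ε * ε * dipoleDenom k ε ≤ toℚ 5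
dipoleDenom-bound k ε 0≤ε ε≤1 u≡1 = begin
  ε * ε * D
      ≡⟨ +-identityʳ _ ⟨
  ε * ε * D + 0ℚ
      ≤⟨ +-monoʳ-≤ (ε * ε * D) (*-monoˡ-≤-nonNeg (toℚ 2) (0≤ε*ε)) ⟩
  ε * ε * D + toℚ 2 * (ε * ε)
      ≡⟨ dipoleDenom-identity k ε ⟩
  toℚ 2 * ε * u + u * u * ((½ + ε) + (½ + ε))
      ≡⟨ cong (λ v → toℚ 2 * ε * v + v * v * ((½ + ε) + (½ + ε))) u≡1 ⟩
  toℚ 2 * ε * 1ℚ + 1ℚ * 1ℚ * ((½ + ε) + (½ + ε))
      ≤⟨ +-mono-≤ (*-monoʳ-≤-nonNeg 1ℚ (*-monoˡ-≤-nonNeg (toℚ 2) ε≤1))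
                  (*-monoˡ-≤-nonNeg (1ℚ * 1ℚ) (+-mono-≤ (+-monoʳ-≤ ½ ε≤1) (+-monoʳ-≤ ½ ε≤1))) ⟩
  toℚ 5  ∎
  where
  open ≤-Reasoning
  D u : ℚ
  D = dipoleDenom k ε
  u = (toℚ 2 + k) * ε
  0≤ε*ε : 0ℚ ≤ ε * ε
  0≤ε*ε = *-nonNeg 0≤ε 0≤ε

module _ (K : ℕ) where

  -- From here on M = K + 2, so that level 0 has room for the two support points.
  private
    M : ℕ
    M = suc (suc K)

  edgeSum-twoPoint : ∀ F → (∀ w → F w 0ℚ 0ℚ ≡ 0ℚ) → ∀ a b →
    edgeSum M (twoPoint M a b) F
      ≡ (F 1ℚ a b + toℚ (K ℕ.* 1) * (F 1ℚ a 0ℚ + F 1ℚ b 0ℚ))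
        + toℚ (levelSize M 1) * (F (crossWeight M) a 0ℚ + F (crossWeight M) b 0ℚ)
  edgeSum-twoPoint F F00 a b = begin
    edgeSum M x F
        ≡⟨ edgeSum-levels M x F ⟩
    sumℕ (numLevels M) clique + sumℕ (numLevels M ℕ.∸ 1) bipartite
        ≡⟨ cong₂ _+_ (sumℕ-head (suc (K ℕ.+ 1 ℕ.* M)) clique higherClique)
                     (sumℕ-head (K ℕ.+ 1 ℕ.* M) bipartite higherBipartite) ⟩
    clique 0 + bipartite 0
        ≡⟨ cong₂ _+_ (cliqueSum-twoPoint (K ℕ.* 1) (F 1ℚ) a b (F00 1ℚ))
                     (bipartiteSum-twoPoint (K ℕ.* 1) (levelSize M 1) cw a b (F00 (crossWeight M))) ⟩
    (F 1ℚ a b + toℚ (K ℕ.* 1) * (F 1ℚ a 0ℚ + F 1ℚ b 0ℚ))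
      + toℚ (levelSize M 1) * (F (crossWeight M) a 0ℚ + F (crossWeight M) b 0ℚ)
        ∎
    where
    open ≡-Reasoning
    x : Assignment M
    x = twoPoint M a b
    cw : ℚ → ℚ → ℚ
    cw = F (crossWeight M)
    clique bipartite : ℕ → ℚ
    clique i = cliqueSum (levelSize M i) (F 1ℚ) (x i)
    bipartite i = bipartiteSum (levelSize M i) (levelSize M (suc i)) cw (x i) (x (suc i))
    higherClique : ∀ i → clique (suc i) ≡ 0ℚ
    higherClique i = cliqueSum-zero (levelSize M (suc i)) (F 1ℚ) (F00 1ℚ)
    higherBipartite : ∀ i → bipartite (suc i) ≡ 0ℚ
    higherBipartite i =
      bipartiteSum-zero (levelSize M (suc i)) (levelSize M (suc (suc i))) cw (F00 (crossWeight M))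

  dipole : Assignment M
  dipole = twoPoint M 1ℚ (- 1ℚ)

  dipole-bounded : ∀ i j → InUnitInterval (dipole i j)
  dipole-bounded = twoPoint-bounded M 1ℚ (- 1ℚ)
    (toWitness {a? = (-[1+ 0 ] / 1) ≤? 1ℚ} _ , ≤-refl)
    (≤-refl , toWitness {a? = (- 1ℚ) ≤? 1ℚ} _)

  -- Only the edge between the two poles has a nonzero product.
  numer-dipole : numer M dipole ≡ 1ℚ
  numer-dipole = begin
    numer M dipole
        ≡⟨ edgeSum-twoPoint (λ w a b → - (w * a * b)) (λ w → product-zeroʳ w 0ℚ) 1ℚ (- 1ℚ) ⟩
    (1ℚ + toℚ (K ℕ.* 1) * 0ℚ)
      + toℚ (levelSize M 1) * (- (crossWeight M * 1ℚ * 0ℚ) + - (crossWeight M * - 1ℚ * 0ℚ))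
        ≡⟨ cong₂ (λ p q → (1ℚ + p) + toℚ (levelSize M 1) * q) (*-zeroʳ (toℚ (K ℕ.* 1)))
                 (cong₂ _+_ (product-zeroʳ (crossWeight M) 1ℚ) (product-zeroʳ (crossWeight M) (- 1ℚ))) ⟩
    1ℚ + toℚ (levelSize M 1) * 0ℚ
        ≡⟨ cong (1ℚ +_) (*-zeroʳ (toℚ (levelSize M 1))) ⟩
    1ℚ  ∎
    where
    open ≡-Reasoning
    product-zeroʳ : ∀ w a → - (w * a * 0ℚ) ≡ 0ℚ
    product-zeroʳ w a = cong -_ (*-zeroʳ (w * a))

  denom-dipole : denom M dipole ≡ dipoleDenom (toℚ K) (eps M)
  denom-dipole = begin
    denom M dipole
        ≡⟨ edgeSum-twoPoint (λ w a b → ∣ w ∣ * (a * a + b * b)) (λ w → *-zeroʳ ∣ w ∣) 1ℚ (- 1ℚ) ⟩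
    (toℚ 2 + toℚ (K ℕ.* 1) * toℚ 2) + toℚ (M ℕ.* (M ℕ.* 1)) * (∣ cw ∣ * 1ℚ + ∣ cw ∣ * 1ℚ)
        ≡⟨ cong₂ (λ k l → (toℚ 2 + k * toℚ 2) + l) (cong toℚ (ℕₚ.*-identityʳ K))
                 (cong₂ _*_ levelSize₁ (cong₂ _+_ ∣cw∣*1 ∣cw∣*1)) ⟩
    dipoleDenom (toℚ K) (eps M)  ∎
    where
    open ≡-Reasoning
    cw : ℚ
    cw = crossWeight M
    toℚM : toℚ M ≡ toℚ 2 + toℚ K
    toℚM = toℚ-+ 2 K
    levelSize₁ : toℚ (M ℕ.* (M ℕ.* 1)) ≡ (toℚ 2 + toℚ K) * (toℚ 2 + toℚ K)
    levelSize₁ = trans (toℚ-* M (M ℕ.* 1)) (cong₂ _*_ toℚM (trans (cong toℚ (ℕₚ.*-identityʳ M)) toℚM))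
    ∣cw∣*1 : ∣ cw ∣ * 1ℚ ≡ cw
    ∣cw∣*1 = trans (*-identityʳ ∣ cw ∣)
                   (0≤p⇒∣p∣≡p (+-mono-≤ (nonNegative⁻¹ ½) (eps-nonNeg M)))

  private
    toℚM*eps : (toℚ 2 + toℚ K) * eps M ≡ 1ℚ
    toℚM*eps = trans (cong (_* eps M) (sym (toℚ-+ 2 K))) (toℚ*eps (suc K))

  denom-dipole-pos : 0ℚ < denom M dipole
  denom-dipole-pos = subst (0ℚ <_) (sym denom-dipole)
    (dipoleDenom-pos (toℚ K) (eps M) (nonNegative⁻¹ (toℚ K)) (eps-nonNeg M))

  dipole-ratio : (ℤ.+ 1 / 5) * (eps M * eps M) * denom M dipole ≤ numer M dipole
  dipole-ratio = begin
    c * (ε * ε) * denom M dipole        ≡⟨ cong (c * (ε * ε) *_) denom-dipole ⟩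
    c * (ε * ε) * dipoleDenom (toℚ K) ε ≡⟨ *-assoc c (ε * ε) _ ⟩
    c * (ε * ε * dipoleDenom (toℚ K) ε) ≤⟨ *-monoˡ-≤-nonNeg c
                                             (dipoleDenom-bound (toℚ K) ε (eps-nonNeg M) (eps≤1 (suc K)) toℚM*eps) ⟩
    c * toℚ 5                           ≡⟨ sym numer-dipole ⟩   -- c * 5 is 1
    numer M dipole                      ∎
    where
    open ≤-Reasoning
    c ε : ℚ
    c = ℤ.+ 1 / 5
    ε = eps M

lemma3p3 : Σ ℚ λ c → (0ℚ < c) × Σ ℕ λ M₀ →
    (M : ℕ) → .{{_ : ℕ.NonZero M}} → M₀ ℕ.≤ M →
    Σ (Assignment M) λ x →
      ((i : ℕ) → i ℕ.< numLevels M → (j : Fin (levelSize M i)) →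
         ((-[1+ 0 ] / 1) ≤ x i j) × (x i j ≤ 1ℚ))
      × (Σ ℕ λ i → (i ℕ.< numLevels M) × Σ (Fin (levelSize M i)) λ j → x i j ≢ 0ℚ)
      × (0ℚ < denom M x)
      × (c * (eps M * eps M) * denom M x ≤ numer M x)
lemma3p3 = ℤ.+ 1 / 5 , positive⁻¹ (ℤ.+ 1 / 5) , 2 , λ where
  (suc zero) (ℕ.s≤s ())
  (suc (suc K)) _ →
    dipole K
    , (λ i _ j → dipole-bounded K i j)
    , (0 , ℕ.s≤s ℕ.z≤n , Fin.zero , λ ())
    , denom-dipole-pos K
    , dipole-ratio K
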